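{- Let $n = 2k$ be an even integer with $n \ge 6$, let $G$ be the king graph on $A=[0;n-1]^2$, let $H$ be the grid graph on $B=[0;k-1]^2$, and for $b\in B$ let $\Phi(b)=2b+[0;1]^2\subseteq A$. Let $P$ be a snake path in $G$ of the greatest possible length $n^2/2-1$, and let $\rho$ be the graph on $B$ whose edges are the pairs $b'b''$ with $b'\ne b''$ such that some edge of $P$ joins a cell of $\Phi(b')$ and a cell of $\Phi(b'')$. Suppose that $b\in B$ is such that $\rho$ contains the edges $(b+(0,1))$---$b$ and $b$---$(b+(1,0))$. Then the two cells of $\Phi(b)$ visited by $P$ are $2b+(0,1)$ and $2b+(1,0)$.
   Context: Cells are points of $\mathbb{Z}^2$; in the king graph distinct cells $(x',y'),(x'',y'')$ are adjacent iff $|x'-x''|\le1$ and $|y'-y''|\le1$; in the grid graph cells are adjacent iff at Euclidean distance $1$. A snake path is a path which is an induced subgraph; length = number of edges. (It is known that such $P$ visits exactly two cells of each $\Phi(b)$.) -}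

module Defs where

open import Data.Nat using (ℕ; suc; _+_; _*_; _≤_; _<_; ∣_-_∣)
open import Data.Fin using (Fin; toℕ; inject₁) renaming (suc to fsuc)
open import Data.Product using (_×_; _,_; Σ; ∃)
open import Data.Sum using (_⊎_)
open import Relation.Binary.PropositionalEquality using (_≡_; _≢_)
open import Relation.Nullary using (¬_)
open import Function.Bundles using (_⇔_)

-- A cell of ℤ², restricted to the nonnegative quadrant (all cells considered lie there).
Cell : Set
Cell = ℕ × ℕ

InSquare : ℕ → Cell → Set
InSquare m (x , y) = x < m × y < m

KingAdj : Cell → Cell → Set
KingAdj c d = c ≢ d × (∣ Data.Product.proj₁ c - Data.Product.proj₁ d ∣ ≤ 1)
                    × (∣ Data.Product.proj₂ c - Data.Product.proj₂ d ∣ ≤ 1)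

-- A path with m edges, given by its sequence of m+1 vertices.
Path : ℕ → Set
Path m = Fin (suc m) → Cell

-- Snake path in the king graph on [0;n-1]²: all vertices in A, pairwise distinct,
-- and two vertices are adjacent iff they are consecutive on the path (induced path).
IsSnake : (n m : ℕ) → Path m → Set
IsSnake n m p =
  (∀ i → InSquare n (p i)) ×
  (∀ i j → p i ≡ p j → i ≡ j) ×
  (∀ i j → KingAdj (p i) (p j) ⇔ (toℕ i ≡ suc (toℕ j) ⊎ toℕ j ≡ suc (toℕ i)))

InΦ : Cell → Cell → Set
InΦ (bx , by) c = Σ ℕ λ dx → Σ ℕ λ dy → dx ≤ 1 × dy ≤ 1 × c ≡ (2 * bx + dx , 2 * by + dy)

ρEdge : {m : ℕ} → Path m → Cell → Cell → Set
ρEdge {m} p b' b'' = b' ≢ b'' × ∃ λ (i : Fin m) →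
    (InΦ b' (p (inject₁ i)) × InΦ b'' (p (fsuc i)))
  ⊎ (InΦ b'' (p (inject₁ i)) × InΦ b' (p (fsuc i)))

{-# OPTIONS --safe #-}
module Submission where

-- Label every vertex of the path by its block and the parity of its index. Two
-- distinct vertices of one block are king-adjacent, hence consecutive on the induced
-- path, hence of different parity: the labelling is injective, and as the path has
-- exactly 2k² vertices, every block holds one vertex of each parity.
-- In Φ(b) let a be the vertex whose path-neighbour lies in the block above and c the
-- one whose path-neighbour lies in the block to the right. Then a ≠ c, so a and c are
-- consecutive; as consecutive indices form no triangle, the upper neighbour is not
-- adjacent to c nor the right one to a, and inside the 2×2 block this forces
-- a = 2b+(0,1) and c = 2b+(1,0).

open import Defs
open import Data.Nat using (ℕ; suc; _+_; _*_; _∸_; _/_; _≤_)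
open import Data.Fin using (Fin)
open import Data.Product using (_×_; _,_; ∃)
open import Data.Sum using (_⊎_)
open import Relation.Binary.PropositionalEquality using (_≡_)

open import Data.Nat using (zero; _<_; z≤n; s≤s; ∣_-_∣; ⌊_/2⌋; parity; _≟_)
open import Data.Nat.Properties
  using (*-suc; *-distribˡ-+; +-assoc; +-identityʳ; suc-injective; ∣m+n-m+o∣≡∣n-o∣; ∣-∣-comm;
         ≤-reflexive; ≤-pred; ≤-trans)
open import Data.Nat.DivMod using (m*n/n≡m)
open import Data.Nat.Tactic.RingSolver using (solve-∀)
open import Data.Parity.Base using (Parity; 0ℙ; 1ℙ)
open import Data.Parity.Properties using (suc-homo-⁻¹; p≢p⁻¹)
open import Data.Fin using (toℕ; fromℕ<; inject₁; combine) renaming (zero to fzero; suc to fsuc)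
open import Data.Fin.Properties
  using (any?; toℕ-inject₁; toℕ-injective; fromℕ<-injective; combine-injective; punchOut-injective;
         <⇒notInjective)
  renaming (_≟_ to _≟ᶠ_)
open import Data.Product using (proj₁; proj₂; ∃₂)
open import Data.Product.Properties using (≡-dec)
open import Data.Sum using (inj₁; inj₂)
open import Data.Empty using (⊥-elim)
open import Function.Base using (_∘_)
open import Function.Bundles using (Equivalence; _⇔_)
open import Function.Definitions using (Injective)
open import Relation.Nullary using (¬_; yes; no)
open import Relation.Binary.PropositionalEquality
  using (refl; sym; trans; cong; cong₂; subst; _≢_; module ≡-Reasoning)

Consecutive : ℕ → ℕ → Set
Consecutive x y = x ≡ suc y ⊎ y ≡ suc x

Consecutive-sym : ∀ {x y} → Consecutive x y → Consecutive y x
Consecutive-sym (inj₁ e) = inj₂ e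
Consecutive-sym (inj₂ e) = inj₁ e

Consecutive⇒parity≢ : ∀ {x y} → Consecutive x y → parity x ≢ parity y
Consecutive⇒parity≢ {y = y} (inj₁ refl) e = p≢p⁻¹ (parity (suc y)) (trans e (sym (suc-homo-⁻¹ y)))
Consecutive⇒parity≢ {x = x} (inj₂ refl) e = p≢p⁻¹ (parity (suc x)) (trans (sym e) (sym (suc-homo-⁻¹ x)))

≢∧≢⇒≡ : ∀ {p q r : Parity} → p ≢ q → q ≢ r → p ≡ r
≢∧≢⇒≡ {0ℙ} {0ℙ} p≢q _ = ⊥-elim (p≢q refl)
≢∧≢⇒≡ {1ℙ} {1ℙ} p≢q _ = ⊥-elim (p≢q refl)
≢∧≢⇒≡ {0ℙ} {1ℙ} {0ℙ} _ _ = refl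
≢∧≢⇒≡ {1ℙ} {0ℙ} {1ℙ} _ _ = refl
≢∧≢⇒≡ {_} {0ℙ} {0ℙ} _ q≢r = ⊥-elim (q≢r refl)
≢∧≢⇒≡ {_} {1ℙ} {1ℙ} _ q≢r = ⊥-elim (q≢r refl)

Consecutive-triangle : ∀ {x y z} → Consecutive x y → Consecutive y z → ¬ Consecutive x z
Consecutive-triangle xy yz xz =
  Consecutive⇒parity≢ xz (≢∧≢⇒≡ (Consecutive⇒parity≢ xy) (Consecutive⇒parity≢ yz))

Consecutive⇒≡⊎≡ : ∀ {a w z u} → Consecutive w a → Consecutive z a → w ≢ z →
                  Consecutive u a → u ≡ w ⊎ u ≡ z
Consecutive⇒≡⊎≡ (inj₁ refl) _           _   (inj₁ refl) = inj₁ refl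
Consecutive⇒≡⊎≡ (inj₂ refl) (inj₁ refl) _   (inj₁ refl) = inj₂ refl
Consecutive⇒≡⊎≡ (inj₂ refl) (inj₂ e)    w≢z (inj₁ refl) = ⊥-elim (w≢z (suc-injective e))
Consecutive⇒≡⊎≡ (inj₂ refl) _           _   (inj₂ e)    = inj₁ (sym (suc-injective e))
Consecutive⇒≡⊎≡ (inj₁ refl) (inj₂ refl) _   (inj₂ e)    = inj₂ (sym (suc-injective e))
Consecutive⇒≡⊎≡ (inj₁ refl) (inj₁ refl) w≢z (inj₂ _)    = ⊥-elim (w≢z refl)

inject₁~fsuc : ∀ {m} (i : Fin m) → Consecutive (toℕ (inject₁ i)) (toℕ (fsuc i))
inject₁~fsuc i = inj₂ (cong suc (sym (toℕ-inject₁ i)))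

⌊2b+d/2⌋≡b : ∀ b {d} → d ≤ 1 → ⌊ 2 * b + d /2⌋ ≡ b
⌊2b+d/2⌋≡b zero    z≤n       = refl
⌊2b+d/2⌋≡b zero    (s≤s z≤n) = refl
⌊2b+d/2⌋≡b (suc b) {d} d≤1   =
  subst (λ t → ⌊ t + d /2⌋ ≡ suc b) (sym (*-suc 2 b)) (cong suc (⌊2b+d/2⌋≡b b d≤1))

n≡2⌊n/2⌋+d : ∀ n → ∃ λ d → d ≤ 1 × n ≡ 2 * ⌊ n /2⌋ + d
n≡2⌊n/2⌋+d zero          = 0 , z≤n , refl
n≡2⌊n/2⌋+d (suc zero)    = 1 , s≤s z≤n , refl
n≡2⌊n/2⌋+d (suc (suc n)) with n≡2⌊n/2⌋+d n
... | d , d≤1 , n≡ = d , d≤1 , trans (cong (2 +_) n≡) (cong (_+ d) (sym (*-suc 2 ⌊ n /2⌋)))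

n<2k⇒⌊n/2⌋<k : ∀ n k → n < 2 * k → ⌊ n /2⌋ < k
n<2k⇒⌊n/2⌋<k _             zero    ()
n<2k⇒⌊n/2⌋<k zero          (suc k) _ = s≤s z≤n
n<2k⇒⌊n/2⌋<k (suc zero)    (suc k) _ = s≤s z≤n
n<2k⇒⌊n/2⌋<k (suc (suc n)) (suc k) n<2k =
  s≤s (n<2k⇒⌊n/2⌋<k n k (≤-pred (≤-pred (subst (3 + n ≤_) (*-suc 2 k) n<2k))))

∣d-e∣≤1 : ∀ {d e} → d ≤ 1 → e ≤ 1 → ∣ d - e ∣ ≤ 1
∣d-e∣≤1 z≤n       z≤n       = z≤n
∣d-e∣≤1 z≤n       (s≤s z≤n) = s≤s z≤n
∣d-e∣≤1 (s≤s z≤n) z≤n       = s≤s z≤n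
∣d-e∣≤1 (s≤s z≤n) (s≤s z≤n) = z≤n

∣2b+d-[2b+e]∣≤1 : ∀ b {d e} → d ≤ 1 → e ≤ 1 → ∣ 2 * b + d - (2 * b + e) ∣ ≤ 1
∣2b+d-[2b+e]∣≤1 b {d} {e} d≤1 e≤1 = subst (_≤ 1) (sym (∣m+n-m+o∣≡∣n-o∣ (2 * b) d e)) (∣d-e∣≤1 d≤1 e≤1)

∣2[b+1]+e-[2b+d]∣≡∣2+e-d∣ : ∀ b d e → ∣ 2 * (b + 1) + e - (2 * b + d) ∣ ≡ ∣ 2 + e - d ∣
∣2[b+1]+e-[2b+d]∣≡∣2+e-d∣ b d e = trans
  (cong (λ t → ∣ t + e - (2 * b + d) ∣) (*-distribˡ-+ 2 b 1))
  (trans (cong (λ t → ∣ t - (2 * b + d) ∣) (+-assoc (2 * b) 2 e)) (∣m+n-m+o∣≡∣n-o∣ (2 * b) (2 + e) d))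

-- Close cells of neighbouring blocks lie on the two lines along their common boundary.
boundary-offsets : ∀ b {d e} → d ≤ 1 → e ≤ 1 →
                   ∣ 2 * (b + 1) + e - (2 * b + d) ∣ ≤ 1 → d ≡ 1 × e ≡ 0
boundary-offsets b {d} {e} d≤1 e≤1 close =
  offsets d≤1 e≤1 (subst (_≤ 1) (∣2[b+1]+e-[2b+d]∣≡∣2+e-d∣ b d e) close)
  where
  offsets : ∀ {d e} → d ≤ 1 → e ≤ 1 → ∣ 2 + e - d ∣ ≤ 1 → d ≡ 1 × e ≡ 0
  offsets z≤n       z≤n       (s≤s ())
  offsets z≤n       (s≤s z≤n) (s≤s ())
  offsets (s≤s z≤n) z≤n       _ = refl , refl
  offsets (s≤s z≤n) (s≤s z≤n) (s≤s ())

boundary-close : ∀ b → ∣ 2 * (b + 1) + 0 - (2 * b + 1) ∣ ≤ 1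
boundary-close b = subst (_≤ 1) (sym (∣2[b+1]+e-[2b+d]∣≡∣2+e-d∣ b 1 0)) (s≤s z≤n)

block : Cell → Cell
block (x , y) = ⌊ x /2⌋ , ⌊ y /2⌋

InΦ⇒block≡ : ∀ {b c} → InΦ b c → block c ≡ b
InΦ⇒block≡ {bx , by} (_ , _ , dx≤1 , dy≤1 , refl) = cong₂ _,_ (⌊2b+d/2⌋≡b bx dx≤1) (⌊2b+d/2⌋≡b by dy≤1)

InΦ-block : ∀ c → InΦ (block c) c
InΦ-block (x , y) with n≡2⌊n/2⌋+d x | n≡2⌊n/2⌋+d y
... | dx , dx≤1 , x≡ | dy , dy≤1 , y≡ = dx , dy , dx≤1 , dy≤1 , cong₂ _,_ x≡ y≡

InΦ-unique : ∀ {b b' c} → InΦ b c → InΦ b' c → b ≡ b'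
InΦ-unique hb hb' = trans (sym (InΦ⇒block≡ hb)) (InΦ⇒block≡ hb')

InΦ-≢ : ∀ {b b' c d} → InΦ b c → InΦ b' d → b ≢ b' → c ≢ d
InΦ-≢ hc hd b≢b' refl = b≢b' (InΦ-unique hc hd)

InΦ⇒KingAdj : ∀ {b c d} → InΦ b c → InΦ b d → c ≢ d → KingAdj c d
InΦ⇒KingAdj {bx , by} (_ , _ , dx≤1 , dy≤1 , refl) (_ , _ , ex≤1 , ey≤1 , refl) c≢d =
  c≢d , ∣2b+d-[2b+e]∣≤1 bx dx≤1 ex≤1 , ∣2b+d-[2b+e]∣≤1 by dy≤1 ey≤1

block-inSquare : ∀ {k c} → InSquare (2 * k) c → InSquare k (block c)
block-inSquare {k} {x , y} (x< , y<) = n<2k⇒⌊n/2⌋<k x k x< , n<2k⇒⌊n/2⌋<k y k y<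

b+1≢b : ∀ b → b + 1 ≢ b
b+1≢b zero    ()
b+1≢b (suc b) = b+1≢b b ∘ suc-injective

module Block (bx by : ℕ) where
  above≢ : (bx , by + 1) ≢ (bx , by)
  above≢ = b+1≢b by ∘ cong proj₂

  right≢ : (bx + 1 , by) ≢ (bx , by)
  right≢ = b+1≢b bx ∘ cong proj₁

  above≢right : (bx , by + 1) ≢ (bx + 1 , by)
  above≢right = b+1≢b bx ∘ sym ∘ cong proj₁

  -- boundary-offsets puts A in the top row and C in the right column; each other
  -- placement would make W adjacent to C, Z adjacent to A, or A = C.
  turn-cells : ∀ {A C W Z} →
    InΦ (bx , by) A → InΦ (bx , by) C → InΦ (bx , by + 1) W → InΦ (bx + 1 , by) Z →
    A ≢ C → KingAdj W A → KingAdj C Z → ¬ KingAdj Z A → ¬ KingAdj W C →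
    A ≡ (2 * bx , 2 * by + 1) × C ≡ (2 * bx + 1 , 2 * by)
  turn-cells hA@(_ , _ , dxa≤1 , dya≤1 , refl) hC@(dxc , _ , dxc≤1 , dyc≤1 , refl)
             hW@(_ , _ , ewx≤1 , ewy≤1 , refl) hZ@(ezx , _ , ezx≤1 , ezy≤1 , refl)
             A≢C (_ , _ , WA-y) (_ , CZ-x , _) Z≁A W≁C
    with boundary-offsets by dya≤1 ewy≤1 WA-y
       | boundary-offsets bx dxc≤1 ezx≤1 (subst (_≤ 1) (∣-∣-comm (2 * bx + dxc) (2 * (bx + 1) + ezx)) CZ-x)
  ... | refl , refl | refl , refl with dxa≤1 | dyc≤1
  ... | z≤n       | z≤n       =
    cong (_, 2 * by + 1) (+-identityʳ (2 * bx)) , cong (2 * bx + 1 ,_) (+-identityʳ (2 * by))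
  ... | z≤n       | s≤s z≤n   =
    ⊥-elim (W≁C (InΦ-≢ hW hC above≢ , ∣2b+d-[2b+e]∣≤1 bx ewx≤1 (s≤s z≤n) , boundary-close by))
  ... | s≤s z≤n   | z≤n       =
    ⊥-elim (Z≁A (InΦ-≢ hZ hA right≢ , boundary-close bx , ∣2b+d-[2b+e]∣≤1 by ezy≤1 (s≤s z≤n)))
  ... | s≤s z≤n   | s≤s z≤n   = ⊥-elim (A≢C refl)

injective⇒surjective : ∀ {m n} {f : Fin m → Fin n} → n ≤ m → Injective _≡_ _≡_ f →
                       ∀ t → ∃ λ i → f i ≡ t
injective⇒surjective {n = zero} _ _ ()
injective⇒surjective {n = suc _} {f} n≤m f-inj t with any? (λ i → f i ≟ᶠ t)
... | yes hit  = hit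
... | no  miss = ⊥-elim (<⇒notInjective n≤m (f-inj ∘ punchOut-injective (f≢t _) (f≢t _)))
  where
  f≢t : ∀ i → t ≢ f i
  f≢t i t≡fi = miss (i , sym t≡fi)

parityIndex : Parity → Fin 2
parityIndex 0ℙ = fzero
parityIndex 1ℙ = fsuc fzero

parityIndex-injective : Injective _≡_ _≡_ parityIndex
parityIndex-injective {0ℙ} {0ℙ} _ = refl
parityIndex-injective {1ℙ} {1ℙ} _ = refl
parityIndex-injective {0ℙ} {1ℙ} ()
parityIndex-injective {1ℙ} {0ℙ} ()

squareIndex : ∀ {k} b → InSquare k b → Fin (k * k)
squareIndex (x , y) (x<k , y<k) = combine (fromℕ< x<k) (fromℕ< y<k)

squareIndex-injective : ∀ {k b b'} (hb : InSquare k b) (hb' : InSquare k b') →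
                        squareIndex b hb ≡ squareIndex b' hb' → b ≡ b'
squareIndex-injective {b = x , y} {x' , y'} (x<k , y<k) (x'<k , y'<k) eq
  with combine-injective (fromℕ< x<k) (fromℕ< y<k) (fromℕ< x'<k) (fromℕ< y'<k) eq
... | x≡ , y≡ = cong₂ _,_ (fromℕ<-injective x x' x<k x'<k x≡) (fromℕ<-injective y y' y<k y'<k y≡)

module InducedPath {m : ℕ} (p : Path m) (p-injective : ∀ i j → p i ≡ p j → i ≡ j)
                   (induced : ∀ i j → KingAdj (p i) (p j) ⇔ Consecutive (toℕ i) (toℕ j)) where

  sameΦ⇒≡⊎Consecutive : ∀ b {i j} → InΦ b (p i) → InΦ b (p j) → i ≡ j ⊎ Consecutive (toℕ i) (toℕ j)
  sameΦ⇒≡⊎Consecutive b {i} {j} hi hj with ≡-dec _≟_ _≟_ (p i) (p j)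
  ... | yes pi≡pj = inj₁ (p-injective i j pi≡pj)
  ... | no  pi≢pj = inj₂ (Equivalence.to (induced i j) (InΦ⇒KingAdj {b} hi hj pi≢pj))

  module _ (k : ℕ) (inSquare : ∀ i → InSquare (2 * k) (p i)) (long : k * k * 2 ≤ suc m) where

    inBlockSquare : ∀ i → InSquare k (block (p i))
    inBlockSquare i = block-inSquare {k} {p i} (inSquare i)

    blockIndex : Fin (suc m) → Fin (k * k)
    blockIndex i = squareIndex (block (p i)) (inBlockSquare i)

    code : Fin (suc m) → Fin (k * k * 2)
    code i = combine (blockIndex i) (parityIndex (parity (toℕ i)))

    -- Two vertices of one block with indices of equal parity would be king-adjacent
    -- without being consecutive.
    code-injective : Injective _≡_ _≡_ code
    code-injective {i} {j} eq
      with combine-injective (blockIndex i) (parityIndex (parity (toℕ i)))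
                             (blockIndex j) (parityIndex (parity (toℕ j))) eq
    ... | block≡ , parity≡
      with sameΦ⇒≡⊎Consecutive (block (p i)) (InΦ-block (p i))
             (subst (λ b → InΦ b (p j)) (sym (squareIndex-injective (inBlockSquare i) (inBlockSquare j) block≡))
                    (InΦ-block (p j)))
    ... | inj₁ i≡j = i≡j
    ... | inj₂ i~j = ⊥-elim (Consecutive⇒parity≢ i~j (parityIndex-injective parity≡))

    vertex-of-parity : ∀ b → InSquare k b → ∀ s → ∃ λ i → InΦ b (p i) × parity (toℕ i) ≡ s
    vertex-of-parity b hb s
      with injective⇒surjective long code-injective (combine (squareIndex b hb) (parityIndex s))
    ... | i , eq
      with combine-injective (blockIndex i) (parityIndex (parity (toℕ i))) (squareIndex b hb) (parityIndex s) eq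
    ... | block≡ , parity≡ =
      i , subst (λ b' → InΦ b' (p i)) (squareIndex-injective (inBlockSquare i) hb block≡) (InΦ-block (p i)) ,
      parityIndex-injective parity≡

    two-vertices-in-block : ∀ b → InSquare k b → ∃₂ λ u v → u ≢ v × InΦ b (p u) × InΦ b (p v)
    two-vertices-in-block b hb with vertex-of-parity b hb 0ℙ | vertex-of-parity b hb 1ℙ
    ... | u , hu , even | v , hv , odd = u , v , u≢v , hu , hv
      where
      u≢v : u ≢ v
      u≢v refl with trans (sym even) odd
      ... | ()

  InΦ-apart : ∀ {b' b'' i j} → InΦ b' (p i) → InΦ b'' (p j) → b' ≢ b'' → toℕ i ≢ toℕ j
  InΦ-apart hi hj b'≢b'' i≡j = InΦ-≢ hi hj b'≢b'' (cong p (toℕ-injective i≡j))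

  Crossing : Cell → Cell → Set
  Crossing b' b'' = ∃₂ λ i j → Consecutive (toℕ i) (toℕ j) × InΦ b' (p i) × InΦ b'' (p j)

  ρEdge⇒Crossing : ∀ {b' b''} → ρEdge p b' b'' → Crossing b' b''
  ρEdge⇒Crossing (_ , e , inj₁ (h' , h'')) = inject₁ e , fsuc e , inject₁~fsuc e , h' , h''
  ρEdge⇒Crossing (_ , e , inj₂ (h'' , h')) = fsuc e , inject₁ e , Consecutive-sym (inject₁~fsuc e) , h' , h''

  turn-vertices : ∀ bx by → Crossing (bx , by + 1) (bx , by) → Crossing (bx , by) (bx + 1 , by) →
    (∃₂ λ u v → u ≢ v × InΦ (bx , by) (p u) × InΦ (bx , by) (p v)) →
    (∃ λ i → p i ≡ (2 * bx , 2 * by + 1)) × (∃ λ j → p j ≡ (2 * bx + 1 , 2 * by)) ×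
    (∀ i → InΦ (bx , by) (p i) → p i ≡ (2 * bx , 2 * by + 1) ⊎ p i ≡ (2 * bx + 1 , 2 * by))
  turn-vertices bx by (w , a , w~a , hw , ha) (c , z , c~z , hc , hz) (u , v , u≢v , hu , hv) =
    (a , pa) , (c , pc) , only-a-c
    where
    open Block bx by
    -- If a = c, both path-neighbours of a lie outside Φ(b), so a is the only vertex of Φ(b).
    a≢c : a ≢ c
    a≢c refl = u≢v (trans (pinned hu) (sym (pinned hv)))
      where
      pinned : ∀ {t} → InΦ (bx , by) (p t) → t ≡ a
      pinned ht with sameΦ⇒≡⊎Consecutive (bx , by) ht ha
      ... | inj₁ t≡a = t≡a
      ... | inj₂ t~a with Consecutive⇒≡⊎≡ w~a (Consecutive-sym c~z) (InΦ-apart hw hz above≢right) t~a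
      ... | inj₁ t≡w = ⊥-elim (InΦ-apart ht hw (above≢ ∘ sym) t≡w)
      ... | inj₂ t≡z = ⊥-elim (InΦ-apart ht hz (right≢ ∘ sym) t≡z)

    a~c : Consecutive (toℕ a) (toℕ c)
    a~c with sameΦ⇒≡⊎Consecutive (bx , by) ha hc
    ... | inj₁ a≡c = ⊥-elim (a≢c a≡c)
    ... | inj₂ a~c = a~c

    corners : p a ≡ (2 * bx , 2 * by + 1) × p c ≡ (2 * bx + 1 , 2 * by)
    corners = turn-cells ha hc hw hz (a≢c ∘ p-injective a c)
      (Equivalence.from (induced w a) w~a) (Equivalence.from (induced c z) c~z)
      (λ z≈a → Consecutive-triangle a~c c~z (Consecutive-sym (Equivalence.to (induced z a) z≈a)))
      (λ w≈c → Consecutive-triangle w~a a~c (Equivalence.to (induced w c) w≈c))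

    pa : p a ≡ (2 * bx , 2 * by + 1)
    pa = proj₁ corners

    pc : p c ≡ (2 * bx + 1 , 2 * by)
    pc = proj₂ corners

    only-a-c : ∀ i → InΦ (bx , by) (p i) → p i ≡ (2 * bx , 2 * by + 1) ⊎ p i ≡ (2 * bx + 1 , 2 * by)
    only-a-c i hi with sameΦ⇒≡⊎Consecutive (bx , by) hi ha | sameΦ⇒≡⊎Consecutive (bx , by) hi hc
    ... | inj₁ refl | _         = inj₁ pa
    ... | inj₂ _    | inj₁ refl = inj₂ pc
    ... | inj₂ i~a  | inj₂ i~c  = ⊥-elim (Consecutive-triangle i~a a~c i~c)

snake-size : ∀ k → 0 < k → suc ((2 * k) * (2 * k) / 2 ∸ 1) ≡ k * k * 2
snake-size k@(suc _) _ = begin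
  suc ((2 * k) * (2 * k) / 2 ∸ 1) ≡⟨ cong (λ t → suc (t / 2 ∸ 1)) (square k) ⟩
  suc (k * k * 2 * 2 / 2 ∸ 1)     ≡⟨ cong (λ t → suc (t ∸ 1)) (m*n/n≡m (k * k * 2) 2) ⟩
  k * k * 2                       ∎
  where
  open ≡-Reasoning
  square : ∀ k → (2 * k) * (2 * k) ≡ k * k * 2 * 2
  square = solve-∀

lemma1 : (n k : ℕ) → n ≡ 2 * k → 6 ≤ n →
    (m : ℕ) → m ≡ (n * n) / 2 ∸ 1 → (p : Path m) → IsSnake n m p →
    (bx by : ℕ) → InSquare k (bx , by) →
    ρEdge p (bx , by + 1) (bx , by) → ρEdge p (bx , by) (bx + 1 , by) →
    (∃ λ (i : Fin (suc m)) → p i ≡ (2 * bx , 2 * by + 1)) ×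
    (∃ λ (j : Fin (suc m)) → p j ≡ (2 * bx + 1 , 2 * by)) ×
    (∀ (i : Fin (suc m)) → InΦ (bx , by) (p i) →
    p i ≡ (2 * bx , 2 * by + 1) ⊎ p i ≡ (2 * bx + 1 , 2 * by))
lemma1 _ k refl _ m refl p (inSquare , p-injective , induced) bx by hb@(bx<k , _) ρ↑ ρ→ =
  turn-vertices bx by (ρEdge⇒Crossing ρ↑) (ρEdge⇒Crossing ρ→)
                (two-vertices-in-block k inSquare long (bx , by) hb)
  where
  open InducedPath p p-injective induced
  long : k * k * 2 ≤ suc m
  long = ≤-reflexive (sym (snake-size k (≤-trans (s≤s z≤n) bx<k)))
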